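{- Let $\varepsilon$ be a system of equations as described, let $\varepsilon_i$ be an entry of the form $u_i\cdot v_i=w_i$, and let $\mathcal{M}$ be a well-prepared finite structure satisfying the conjunction of $\forall y\,(A_{w_i}(y)\to\exists x\,M_i(x,y))\wedge\forall x\forall y\,(M_i(x,y)\to(A_{u_i}(x)\wedge A_{w_i}(y)))$, $\forall x\,\big(A_{u_i}(x)\to\exists^{=50\%}y\,([S_i(y)\wedge\neg M_i(x,y)]\vee A_{v_i}(y))\big)$, and $\forall x\,\big(A_{w_i}(x)\to\exists^{=50\%}y\,([S_i(y)\wedge x\neq y]\vee M_i(y,x))\big)$. Then $|A_{u_i}^{\mathcal{M}}|\cdot|A_{v_i}^{\mathcal{M}}|=|A_{w_i}^{\mathcal{M}}|$.
   Context: A system $\varepsilon$ consists of entries $\varepsilon_1,\dots,\varepsilon_m$, each of one of the forms $u=1$, $u=v+w$ or $u=v\cdot w$ (written $u_i+v_i=w_i$ resp. $u_i\cdot v_i=w_i$ for three-variable entries), with pairwise distinct variables in each entry; $\mathrm{Var}(\varepsilon)$ is the set of variables occurring. The signature contains unary predicates $A_u$ ($u\in\mathrm{Var}(\varepsilon)$), unary predicates $F_i,S_i$ and a binary predicate $M_i$ for each $i$. A finite structure $\mathcal{M}$ (domain $M$) is well-prepared if: (1) no element satisfies $A_u$ and $A_v$ for distinct $u,v$; (2) for each entry $u_i=1$, exactly one element satisfies $A_{u_i}$; (3) for each entry of form $u_i+v_i=w_i$ or $u_i\cdot v_i=w_i$: every element satisfies exactly one of $F_i,S_i$, exactly half of the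 elements satisfy $F_i$, elements satisfying $A_{u_i}$ or $A_{v_i}$ satisfy $F_i$, and elements satisfying $A_{w_i}$ satisfy $S_i$. The formula $\exists^{=50\%}y\,\psi(x,y)$ holds at $x/a$ iff exactly $\frac12|M|$ elements $b$ satisfy $\psi(a,b)$. -}

module Defs where

open import Data.Nat using (ℕ; zero; suc; _+_; _*_)
open import Data.Bool using (Bool; true; false; if_then_else_; _∧_; _∨_; not; T)
open import Data.Fin using (Fin; zero; suc)
open import Data.Product using (_×_; ∃)
open import Data.Sum using (_⊎_)
open import Relation.Binary.PropositionalEquality using (_≡_; _≢_)
open import Relation.Nullary using (¬_)
open import Data.Unit using (⊤)

Var : Set
Var = ℕ

-- An entry of a system:  one u  is  u = 1,
-- plus u v w  is  u + v = w,  times u v w  is  u · v = w.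
data Entry : Set where
  one   : Var → Entry
  plus  : Var → Var → Var → Entry
  times : Var → Var → Var → Entry

EntryWF : Entry → Set
EntryWF (one u) = ⊤
EntryWF (plus u v w)  = (u ≢ v) × (u ≢ w) × (v ≢ w)
EntryWF (times u v w) = (u ≢ v) × (u ≢ w) × (v ≢ w)

System : ℕ → Set
System m = Fin m → Entry

SystemWF : ∀ {m} → System m → Set
SystemWF {m} ε = (i : Fin m) → EntryWF (ε i)

OccursE : Var → Entry → Set
OccursE x (one u) = x ≡ u
OccursE x (plus u v w)  = (x ≡ u) ⊎ (x ≡ v) ⊎ (x ≡ w)
OccursE x (times u v w) = (x ≡ u) ⊎ (x ≡ v) ⊎ (x ≡ w)

Occurs : ∀ {m} → System m → Var → Set
Occurs {m} ε x = ∃ λ (i : Fin m) → OccursE x (ε i)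

record Structure (m : ℕ) : Set where
  field
    size : ℕ
    A    : Var → Fin size → Bool
    F    : Fin m → Fin size → Bool
    S    : Fin m → Fin size → Bool
    M    : Fin m → Fin size → Fin size → Bool

count : ∀ {n} → (Fin n → Bool) → ℕ
count {zero}  p = 0
count {suc n} p = (if p zero then 1 else 0) + count {n} (λ x → p (suc x))

Half : ∀ {n} → (Fin n → Bool) → Set
Half {n} p = 2 * count p ≡ n

module _ {m : ℕ} (ε : System m) (𝓜 : Structure m) where
  open Structure 𝓜

  WellPrepared : Set
  WellPrepared =
    ((u v : Var) → Occurs ε u → Occurs ε v → u ≢ v →
       (a : Fin size) → ¬ (T (A u a) × T (A v a)))
    ×
    ((i : Fin m) (u : Var) → ε i ≡ one u → count (A u) ≡ 1)
    ×
    ((i : Fin m) (u v w : Var) → (ε i ≡ plus u v w ⊎ ε i ≡ times u v w) →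
       ((a : Fin size) → (T (F i a) × ¬ T (S i a)) ⊎ (¬ T (F i a) × T (S i a)))
       × Half (F i)
       × ((a : Fin size) → T (A u a) → T (F i a))
       × ((a : Fin size) → T (A v a) → T (F i a))
       × ((a : Fin size) → T (A w a) → T (S i a)))

-- The relation M i is a double counting device.  In the row of an element x of A u,
-- the first 50%-condition says that replacing the M i-successors of x inside S i by
-- the elements of A v keeps exactly half of the domain, i.e. keeps |S i|; so x has
-- |A v| successors.  Likewise the second condition, with the singleton {x} in place
-- of the row, gives every element of A w exactly one M i-predecessor.  Since M i lies
-- inside A u × A w, counting its pairs by rows and by columns gives |A u|·|A v| = |A w|.
module Submission where

open import Defs
open import Algebra.Properties.CommutativeMonoid.Sum using (sum; sum-cong-≗; ∑-distrib-+; ∑-comm)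
open import Data.Nat using (ℕ; zero; suc; _+_; _*_)
open import Data.Nat.Properties
  using (+-comm; +-identityʳ; +-cancelˡ-≡; *-cancelˡ-≡; *-identityʳ; +-0-commutativeMonoid)
open import Data.Bool using (Bool; true; false; T; _∧_; _∨_; not; if_then_else_)
open import Data.Bool.Properties using (T-∧)
open import Data.Fin using (Fin; _≟_; zero; suc)
open import Data.Product using (_×_; ∃; _,_; proj₁; proj₂)
open import Data.Sum using (_⊎_; inj₁; inj₂; [_,_])
open import Function using (_∘_; Equivalence)
open import Relation.Binary.PropositionalEquality
  using (_≡_; _≗_; refl; sym; trans; cong; cong₂; module ≡-Reasoning)
open import Relation.Nullary using (¬_; yes; no; contradiction)
open import Relation.Nullary.Decidable using (⌊_⌋)

open ≡-Reasoning

∑ : ∀ {n} → (Fin n → ℕ) → ℕ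
∑ = sum +-0-commutativeMonoid

𝟙 : Bool → ℕ
𝟙 b = if b then 1 else 0

T-true : ∀ {b} → b ≡ true → T b
T-true refl = _

T-false : ∀ {b} → b ≡ false → ¬ T b
T-false refl ()

≡not-if-exactly-one : ∀ {f s} → (T f × ¬ T s) ⊎ (¬ T f × T s) → s ≡ not f
≡not-if-exactly-one {true}  {false} _ = refl
≡not-if-exactly-one {false} {true}  _ = refl
≡not-if-exactly-one {true}  {true}  (inj₁ (_ , ¬s)) = contradiction _ ¬s
≡not-if-exactly-one {true}  {true}  (inj₂ (¬f , _)) = contradiction _ ¬f
≡not-if-exactly-one {false} {false} (inj₁ (() , _))
≡not-if-exactly-one {false} {false} (inj₂ (_ , ()))

count≡∑𝟙 : ∀ {n} (p : Fin n → Bool) → count p ≡ ∑ (𝟙 ∘ p)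
count≡∑𝟙 {zero}  p = refl
count≡∑𝟙 {suc n} p = cong (𝟙 (p zero) +_) (count≡∑𝟙 (p ∘ suc))

count-cong : ∀ {n} {p q : Fin n → Bool} → p ≗ q → count p ≡ count q
count-cong {zero}  p≗q = refl
count-cong {suc n} p≗q = cong₂ _+_ (cong 𝟙 (p≗q zero)) (count-cong (p≗q ∘ suc))

count-additive : ∀ {n} {p q r : Fin n → Bool} →
  (∀ a → 𝟙 (r a) ≡ 𝟙 (p a) + 𝟙 (q a)) → count r ≡ count p + count q
count-additive {p = p} {q} {r} split = begin
  count r                       ≡⟨ count≡∑𝟙 r ⟩
  ∑ (𝟙 ∘ r)                     ≡⟨ sum-cong-≗ +-0-commutativeMonoid split ⟩
  ∑ (λ a → 𝟙 (p a) + 𝟙 (q a))   ≡⟨ ∑-distrib-+ +-0-commutativeMonoid (𝟙 ∘ p) (𝟙 ∘ q) ⟩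
  ∑ (𝟙 ∘ p) + ∑ (𝟙 ∘ q)         ≡⟨ sym (cong₂ _+_ (count≡∑𝟙 p) (count≡∑𝟙 q)) ⟩
  count p + count q             ∎

count-∨-disjoint : ∀ {n} (p q : Fin n → Bool) → (∀ a → T (p a) → ¬ T (q a)) →
  count (λ a → p a ∨ q a) ≡ count p + count q
count-∨-disjoint p q disjoint = count-additive (λ a → 𝟙-∨ (disjoint a))
  where
  𝟙-∨ : ∀ {b c} → (T b → ¬ T c) → 𝟙 (b ∨ c) ≡ 𝟙 b + 𝟙 c
  𝟙-∨ {true}  {true}  b⇒¬c = contradiction _ (b⇒¬c _)
  𝟙-∨ {true}  {false} _    = refl
  𝟙-∨ {false} {_}     _    = refl

count-∧-split : ∀ {n} (p q : Fin n → Bool) →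
  count p ≡ count (λ a → p a ∧ q a) + count (λ a → p a ∧ not (q a))
count-∧-split p q = count-additive (λ a → 𝟙-∧ (p a) (q a))
  where
  𝟙-∧ : ∀ b c → 𝟙 b ≡ 𝟙 (b ∧ c) + 𝟙 (b ∧ not c)
  𝟙-∧ true  true  = refl
  𝟙-∧ true  false = refl
  𝟙-∧ false _     = refl

count-all : ∀ n → count {n} (λ _ → true) ≡ n
count-all zero    = refl
count-all (suc n) = cong suc (count-all n)

count-complement : ∀ {n} (p : Fin n → Bool) → count p + count (not ∘ p) ≡ n
count-complement {n} p = begin
  count p + count (not ∘ p) ≡⟨ count-additive (λ a → 𝟙-not (p a)) ⟨
  count {n} (λ _ → true)    ≡⟨ count-all n ⟩
  n                         ∎
  where
  𝟙-not : ∀ b → 𝟙 true ≡ 𝟙 b + 𝟙 (not b)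
  𝟙-not true  = refl
  𝟙-not false = refl

count-none : ∀ {n} (p : Fin n → Bool) → (∀ a → ¬ T (p a)) → count p ≡ 0
count-none {zero}  p none = refl
count-none {suc n} p none with p zero in p₀
... | true  = contradiction (T-true p₀) (none zero)
... | false = count-none (p ∘ suc) (none ∘ suc)

count-≟ : ∀ {n} (x : Fin n) → count (λ y → ⌊ x ≟ y ⌋) ≡ 1
count-≟ {suc n} zero    = cong suc (count-none (λ (y : Fin n) → ⌊ zero ≟ suc y ⌋) (λ _ ()))
count-≟ {suc n} (suc x) = trans (count-cong ≟-suc) (count-≟ x)
  where
  ≟-suc : ∀ y → ⌊ suc x ≟ suc y ⌋ ≡ ⌊ x ≟ y ⌋
  ≟-suc y with x ≟ y
  ... | yes _ = refl
  ... | no  _ = refl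

count-exchange : ∀ {n} (p q r : Fin n → Bool) →
  (∀ a → T (q a) → T (p a)) → (∀ a → T (p a) → ¬ T (r a)) →
  count (λ a → (p a ∧ not (q a)) ∨ r a) ≡ count p → count q ≡ count r
count-exchange p q r q⊆p p∩r≡∅ same = +-cancelˡ-≡ rest (count q) (count r) (begin
  rest + count q                          ≡⟨ +-comm rest (count q) ⟩
  count q + rest                          ≡⟨ cong (_+ rest) (count-cong (λ a → ∧-implied (q⊆p a))) ⟨
  count (λ a → p a ∧ q a) + rest          ≡⟨ count-∧-split p q ⟨
  count p                                 ≡⟨ same ⟨
  count (λ a → (p a ∧ not (q a)) ∨ r a)   ≡⟨ count-∨-disjoint _ r (λ a → p∩r≡∅ a ∘ ∧-left) ⟩
  rest + count r                          ∎)
  where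
  rest = count (λ a → p a ∧ not (q a))
  ∧-implied : ∀ {b c} → (T c → T b) → b ∧ c ≡ c
  ∧-implied {true}          _   = refl
  ∧-implied {false} {true}  c⇒b = contradiction (c⇒b _) (λ ())
  ∧-implied {false} {false} _   = refl
  ∧-left : ∀ {b c} → T (b ∧ c) → T b
  ∧-left = proj₁ ∘ Equivalence.to T-∧

Half-unique : ∀ {n} {p q : Fin n → Bool} → Half p → Half q → count p ≡ count q
Half-unique {p = p} {q} half-p half-q = *-cancelˡ-≡ (count p) (count q) 2 (trans half-p (sym half-q))

Half-complement : ∀ {n} {p : Fin n → Bool} → Half p → Half (not ∘ p)
Half-complement {n} {p} half-p = trans (cong (2 *_) count-not≡count) half-p
  where
  count-not≡count : count (not ∘ p) ≡ count p
  count-not≡count = +-cancelˡ-≡ (count p) _ _ (begin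
    count p + count (not ∘ p)  ≡⟨ count-complement p ⟩
    n                          ≡⟨ half-p ⟨
    2 * count p                ≡⟨ cong (count p +_) (+-identityʳ (count p)) ⟩
    count p + count p          ∎)

∑-supported : ∀ {n} (P : Fin n → Bool) (f : Fin n → ℕ) {k : ℕ} →
  (∀ x → T (P x) → f x ≡ k) → (∀ x → ¬ T (P x) → f x ≡ 0) → ∑ f ≡ count P * k
∑-supported {zero}  P f on off = refl
∑-supported {suc n} P f on off with P zero in P₀
... | true  = cong₂ _+_ (on zero (T-true P₀)) rest
  where rest = ∑-supported (P ∘ suc) (f ∘ suc) (on ∘ suc) (off ∘ suc)
... | false = cong₂ _+_ (off zero (T-false P₀)) rest
  where rest = ∑-supported (P ∘ suc) (f ∘ suc) (on ∘ suc) (off ∘ suc)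

double-counting : ∀ {m n} (R : Fin m → Fin n → Bool) {P : Fin m → Bool} {Q : Fin n → Bool} {r c : ℕ} →
  (∀ x y → T (R x y) → T (P x) × T (Q y)) →
  (∀ x → T (P x) → count (R x) ≡ r) → (∀ y → T (Q y) → count (λ x → R x y) ≡ c) →
  count P * r ≡ count Q * c
double-counting R {P} {Q} {r} {c} R⊆P×Q rows columns = begin
  count P * r                       ≡⟨ ∑-supported P (count ∘ R) rows empty-row ⟨
  ∑ (count ∘ R)                     ≡⟨ sum-cong-≗ +-0-commutativeMonoid (count≡∑𝟙 ∘ R) ⟩
  ∑ (λ x → ∑ (λ y → 𝟙 (R x y)))     ≡⟨ ∑-comm +-0-commutativeMonoid (λ x y → 𝟙 (R x y)) ⟩
  ∑ (λ y → ∑ (λ x → 𝟙 (R x y)))     ≡⟨ sum-cong-≗ +-0-commutativeMonoid (sym ∘ count≡∑𝟙 ∘ column) ⟩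
  ∑ (λ y → count (column y))        ≡⟨ ∑-supported Q (count ∘ column) columns empty-column ⟩
  count Q * c                       ∎
  where
  column = λ y x → R x y
  empty-row : ∀ x → ¬ T (P x) → count (R x) ≡ 0
  empty-row x ¬Px = count-none (R x) (λ y Rxy → ¬Px (proj₁ (R⊆P×Q x y Rxy)))
  empty-column : ∀ y → ¬ T (Q y) → count (column y) ≡ 0
  empty-column y ¬Qy = count-none (column y) (λ x Rxy → ¬Qy (proj₂ (R⊆P×Q x y Rxy)))

lemma9 : {m : ℕ} (ε : System m) → SystemWF ε →
    (i : Fin m) (u v w : Var) → ε i ≡ times u v w →
    (𝓜 : Structure m) → WellPrepared ε 𝓜 →
    let open Structure 𝓜 in
    ((y : Fin size) → T (A w y) → ∃ λ x → T (M i x y)) →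
    ((x y : Fin size) → T (M i x y) → T (A u x) × T (A w y)) →
    ((x : Fin size) → T (A u x) →
       Half (λ y → (S i y ∧ not (M i x y)) ∨ A v y)) →
    ((x : Fin size) → T (A w x) →
       Half (λ y → (S i y ∧ not ⌊ x ≟ y ⌋) ∨ M i y x)) →
    count (A u) * count (A v) ≡ count (A w)
lemma9 ε _ i u v w εᵢ≡uvw 𝓜 (_ , _ , prepared) _ M⊆Au×Aw row-half column-half
  with prepared i u v w (inj₂ εᵢ≡uvw)
... | F⊕S , half-F , u⇒F , v⇒F , w⇒S =
  trans (double-counting (M i) M⊆Au×Aw row-size column-size) (*-identityʳ (count (A w)))
  where
  open Structure 𝓜

  F⇒¬S : ∀ a → T (F i a) → ¬ T (S i a)
  F⇒¬S a Fa Sa = [ (λ (_ , ¬Sa) → ¬Sa Sa) , (λ (¬Fa , _) → ¬Fa Fa) ] (F⊕S a)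

  half-S : Half (S i)
  half-S = trans (cong (2 *_) (count-cong (≡not-if-exactly-one ∘ F⊕S))) (Half-complement half-F)

  row-size : ∀ x → T (A u x) → count (M i x) ≡ count (A v)
  row-size x ux = count-exchange (S i) (M i x) (A v)
    (λ y → w⇒S y ∘ proj₂ ∘ M⊆Au×Aw x y)
    (λ y Sy vy → F⇒¬S y (v⇒F y vy) Sy)
    (Half-unique (row-half x ux) half-S)

  column-size : ∀ y → T (A w y) → count (λ x → M i x y) ≡ 1
  column-size y wy = begin
    count (λ x → M i x y)  ≡⟨ count-exchange (S i) (λ x → ⌊ y ≟ x ⌋) (λ x → M i x y)
                                singleton⊆S
                                (λ x Sx Mxy → F⇒¬S x (u⇒F x (proj₁ (M⊆Au×Aw x y Mxy))) Sx)
                                (Half-unique (column-half y wy) half-S) ⟨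
    count (λ x → ⌊ y ≟ x ⌋)  ≡⟨ count-≟ y ⟩
    1                        ∎
    where
    singleton⊆S : ∀ x → T ⌊ y ≟ x ⌋ → T (S i x)
    singleton⊆S x y≡x with y ≟ x
    ... | yes refl = w⇒S y wy
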